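{- Let $S$ be a set, $V$ a vector space and $s\in S$. Then $(S\text{ - }\mathrm{Mag}_{\mathbb K}(V),\veebar_s,\overset{\circledast}{\Delta})$ is a magmatic infinitesimal bialgebra: $\overset{\circledast}{\Delta}$ is coassociative and for all $x,y$ of positive degree, $\overset{\circledast}{\Delta}(x\veebar_sy)=\sum x_{(1)}\otimes(x_{(2)}\veebar_sy)+\sum(x\veebar_sy_{(1)})\otimes y_{(2)}-x\otimes y$, with the convention that the degree-$0$ unit $1$ satisfies $1\veebar_sy=y$, $x\veebar_s1=x$.
   Context: Planar binary rooted trees: every internal vertex has two children; $\mathbf{PBT}_n$ = such trees with $n$ leaves, $\mathbf{PBT}_1=\{\vert\}$; internal vertices ordered left to right. $\mathbf{PBT}^S_n$: pairs $(t,(s_1,\dots,s_{n-1}))$ with $s_i\in S$ the color of the $i$-th internal vertex. $t\veebar w$ joins roots of $t$ (left), $w$ (right) to a new root; $(t,(s_\cdot))\veebar_s(w,(r_\cdot))=(t\veebar w,(s_1,\dots,s_{n-1},s,r_1,\dots,r_{m-1}))$. On $\mathbb K1_{\mathbb K}\oplus\bigoplus_n\mathbb K[\mathbf{PBT}^S_n]$: $\overset{\circledast}{\Delta}(1_{\mathbb K})=1_{\mathbb K}\otimes1_{\mathbb K}$, $\overset{\circledast}{\Delta}(\vert)=1_{\mathbb K}\otimes\vert+\vert\otimes1_{\mathbb K}$, $\overset{\circledast}{\Delta}(T\veebar_rW)=\sum T_{(1)}\otimes(T_{(2)}\veebar_rW)+\sum(T\veebar_rW_{(1)})\otimes W_{(2)}-T\otimes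 W$ ($r\in S$, conventions $1_{\mathbb K}\veebar_rW=W$, $T\veebar_r1_{\mathbb K}=T$); for $T$ of degree $n$, $\overset{\circledast}{\Delta}(T)=\sum_{i=0}^nT^i_{(1)}\otimes T^i_{(2)}$ with $T^i_{(1)}$ of degree $i$. $S\text{ - }\mathrm{Mag}_{\mathbb K}(V)=\mathbb K\oplus\bigoplus_{n\ge1}\mathbb K[\mathbf{PBT}^S_n]\otimes V^{\otimes n}$, with product $(T\otimes v_1\otimes\cdots\otimes v_n)\veebar_s(W\otimes u_1\otimes\cdots\otimes u_m)=(T\veebar_sW)\otimes v_1\otimes\cdots\otimes v_n\otimes u_1\otimes\cdots\otimes u_m$ and coproduct $\overset{\circledast}{\Delta}(T\otimes v_1\otimes\cdots\otimes v_n)=\sum_{i=0}^n(T^i_{(1)}\otimes v_1\otimes\cdots\otimes v_i)\otimes(T^i_{(2)}\otimes v_{i+1}\otimes\cdots\otimes v_n)$. -}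

module Defs where

open import Level using (Level; _⊔_; suc)
open import Data.List using (List; []; _∷_; _++_; map; concatMap)
open import Data.List.Relation.Unary.All using (All)
open import Data.Product using (Σ; _×_; _,_; proj₁; proj₂)
open import Data.Unit using (⊤)
open import Data.Empty using (⊥)
open import Relation.Nullary using (¬_)
open import Relation.Binary.PropositionalEquality using (_≡_)
open import Algebra.Bundles using (CommutativeRing)
open import Algebra.Module.Bundles using (Module)

record Field (c ℓ : Level) : Set (suc (c ⊔ ℓ)) where
  field
    commutativeRing : CommutativeRing c ℓ
  open CommutativeRing commutativeRing public
  field
    0≉1     : ¬ (0# ≈ 1#)
    inverse : ∀ x → ¬ (x ≈ 0#) → Σ Carrier λ y → (x * y) ≈ 1#

VectorSpace : ∀ {c ℓ} (K : Field c ℓ) (m ℓm : Level) → Set _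
VectorSpace K m ℓm = Module (Field.commutativeRing K) m ℓm

-- Free K-module on a set of generators G, modulo the K-submodule generated
-- by a family of basic relations.  Elements are finite formal linear
-- combinations (lists of (coefficient, generator)); _≈F_ is the equality
-- of the quotient module.

module FreeModule {c ℓ g b : Level} (K : Field c ℓ) (G : Set g)
         (Basic : List (Field.Carrier K × G) → List (Field.Carrier K × G) → Set b) where
  open Field K

  Comb : Set (c ⊔ g)
  Comb = List (Carrier × G)

  scale : Carrier → Comb → Comb
  scale a = map (λ p → (a * proj₁ p , proj₂ p))

  infix 4 _≈F_
  data _≈F_ : Comb → Comb → Set (c ⊔ ℓ ⊔ g ⊔ b) where
    basic    : ∀ {xs ys} → Basic xs ys → xs ≈F ys
    ≈F-refl  : ∀ {xs} → xs ≈F xs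
    ≈F-sym   : ∀ {xs ys} → xs ≈F ys → ys ≈F xs
    ≈F-trans : ∀ {xs ys zs} → xs ≈F ys → ys ≈F zs → xs ≈F zs
    ++-cong  : ∀ {xs xs' ys ys'} → xs ≈F xs' → ys ≈F ys' → (xs ++ ys) ≈F (xs' ++ ys')
    scale-cong : ∀ a {xs ys} → xs ≈F ys → scale a xs ≈F scale a ys
    ++-comm  : ∀ xs ys → (xs ++ ys) ≈F (ys ++ xs)
    merge    : ∀ a a' x → ((a , x) ∷ (a' , x) ∷ []) ≈F ((a + a' , x) ∷ [])
    zero-coef : ∀ x → ((0# , x) ∷ []) ≈F []
    coef-cong : ∀ {a a'} x → a ≈ a' → ((a , x) ∷ []) ≈F ((a' , x) ∷ [])

module SMag {c ℓ m ℓm s : Level} (K : Field c ℓ) (V : VectorSpace K m ℓm) (S : Set s) where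
  open Field K
  open Module V using (Carrierᴹ; _≈ᴹ_; _+ᴹ_; _*ₗ_)

  -- A pure tensor T ⊗ v₁ ⊗ ⋯ ⊗ vₙ with T ∈ PBT^S_n (n ≥ 1) is encoded as
  -- the tree T with its internal vertices coloured by S and its i-th leaf
  -- labelled by vᵢ.
  data Tree : Set (m ⊔ s) where
    leaf : Carrierᴹ → Tree
    node : Tree → S → Tree → Tree

  -- Monomials: the degree-0 unit 1_K, or a pure tensor of positive degree.
  data Mono : Set (m ⊔ s) where
    one : Mono
    tr  : Tree → Mono

  IsPositive : Mono → Set
  IsPositive one    = ⊥
  IsPositive (tr _) = ⊤

  -- One-hole contexts (a leaf position) in a tree, for multilinearity in
  -- the tensor factors V.
  data Ctx : Set (m ⊔ s) where
    hole : Ctx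
    inL  : Ctx → S → Tree → Ctx
    inR  : Tree → S → Ctx → Ctx

  plug : Ctx → Carrierᴹ → Tree
  plug hole        v = leaf v
  plug (inL C r w) v = node (plug C v) r w
  plug (inR t r C) v = node t r (plug C v)

  -- Multilinearity relations of K[PBT^S_n] ⊗ V^{⊗n}: a monomial equals a
  -- linear combination of monomials.
  data LinM : Mono → List (Carrier × Mono) → Set (c ⊔ m ⊔ ℓm ⊔ s) where
    lin-add  : ∀ C a u a' w →
      LinM (tr (plug C ((a *ₗ u) +ᴹ (a' *ₗ w))))
           ((a , tr (plug C u)) ∷ (a' , tr (plug C w)) ∷ [])
    lin-resp : ∀ C {u w} → u ≈ᴹ w →
      LinM (tr (plug C u)) ((1# , tr (plug C w)) ∷ [])

  -- The three relevant modules: S-Mag(V), its tensor square and cube.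
  data B₁ : List (Carrier × Mono) → List (Carrier × Mono) → Set (c ⊔ m ⊔ ℓm ⊔ s) where
    b : ∀ {x ys} → LinM x ys → B₁ ((1# , x) ∷ []) ys

  M2 : Set (m ⊔ s)
  M2 = Mono × Mono

  M3 : Set (m ⊔ s)
  M3 = Mono × Mono × Mono

  data B₂ : List (Carrier × M2) → List (Carrier × M2) → Set (c ⊔ m ⊔ ℓm ⊔ s) where
    b₁ : ∀ {x ys y} → LinM x ys →
      B₂ ((1# , (x , y)) ∷ []) (map (λ p → (proj₁ p , (proj₂ p , y))) ys)
    b₂ : ∀ {x y ys} → LinM y ys →
      B₂ ((1# , (x , y)) ∷ []) (map (λ p → (proj₁ p , (x , proj₂ p))) ys)

  data B₃ : List (Carrier × M3) → List (Carrier × M3) → Set (c ⊔ m ⊔ ℓm ⊔ s) where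
    b₁ : ∀ {x ys y z} → LinM x ys →
      B₃ ((1# , (x , y , z)) ∷ []) (map (λ p → (proj₁ p , (proj₂ p , y , z))) ys)
    b₂ : ∀ {x y ys z} → LinM y ys →
      B₃ ((1# , (x , y , z)) ∷ []) (map (λ p → (proj₁ p , (x , proj₂ p , z))) ys)
    b₃ : ∀ {x y z ys} → LinM z ys →
      B₃ ((1# , (x , y , z)) ∷ []) (map (λ p → (proj₁ p , (x , y , proj₂ p))) ys)

  module F₁ = FreeModule K Mono B₁
  module F₂ = FreeModule K M2 B₂
  module F₃ = FreeModule K M3 B₃

  Mag : Set (c ⊔ m ⊔ s)
  Mag = F₁.Comb

  Mag⊗Mag : Set (c ⊔ m ⊔ s)
  Mag⊗Mag = F₂.Comb

  Mag⊗³ : Set (c ⊔ m ⊔ s)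
  Mag⊗³ = F₃.Comb

  _≈₂_ : Mag⊗Mag → Mag⊗Mag → Set _
  _≈₂_ = F₂._≈F_

  _≈₃_ : Mag⊗³ → Mag⊗³ → Set _
  _≈₃_ = F₃._≈F_

  Positive : Mag → Set (c ⊔ m ⊔ s)
  Positive = All (λ p → IsPositive (proj₂ p))

  _⊻⟨_⟩_ : Mono → S → Mono → Mono
  one  ⊻⟨ r ⟩ w    = w
  tr t ⊻⟨ r ⟩ one  = tr t
  tr t ⊻⟨ r ⟩ tr w = tr (node t r w)

  _⊻[_]_ : Mag → S → Mag → Mag
  x ⊻[ r ] y = concatMap (λ p → map (λ q → (proj₁ p * proj₁ q , proj₂ p ⊻⟨ r ⟩ proj₂ q)) y) x

  -ONE : Carrier
  -ONE = - 1#

  Δt : Tree → Mag⊗Mag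
  Δt (leaf v) = (1# , (one , tr (leaf v))) ∷ (1# , (tr (leaf v) , one)) ∷ []
  Δt (node t r w) =
       map (λ p → (proj₁ p , (proj₁ (proj₂ p) , proj₂ (proj₂ p) ⊻⟨ r ⟩ tr w))) (Δt t)
    ++ map (λ p → (proj₁ p , (tr t ⊻⟨ r ⟩ proj₁ (proj₂ p) , proj₂ (proj₂ p)))) (Δt w)
    ++ ((-ONE , (tr t , tr w)) ∷ [])

  Δm : Mono → Mag⊗Mag
  Δm one    = (1# , (one , one)) ∷ []
  Δm (tr t) = Δt t

  Δ : Mag → Mag⊗Mag
  Δ = concatMap (λ p → F₂.scale (proj₁ p) (Δm (proj₂ p)))

  Δ⊗id : Mag⊗Mag → Mag⊗³
  Δ⊗id = concatMap (λ p → map (λ q → (proj₁ p * proj₁ q , (proj₁ (proj₂ q) , proj₂ (proj₂ q) , proj₂ (proj₂ p))))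
                                  (Δm (proj₁ (proj₂ p))))

  id⊗Δ : Mag⊗Mag → Mag⊗³
  id⊗Δ = concatMap (λ p → map (λ q → (proj₁ p * proj₁ q , (proj₁ (proj₂ p) , proj₁ (proj₂ q) , proj₂ (proj₂ q))))
                                  (Δm (proj₂ (proj₂ p))))

  _⊗_ : Mag → Mag → Mag⊗Mag
  x ⊗ y = concatMap (λ p → map (λ q → (proj₁ p * proj₁ q , (proj₂ p , proj₂ q))) y) x

  -- Σ x₍₁₎ ⊗ (x₍₂₎ ⊻_r y), i.e. (id ⊗ (- ⊻_r y)) applied to a tensor
  _⊻ʳ[_]_ : Mag⊗Mag → S → Mag → Mag⊗Mag
  X ⊻ʳ[ r ] y = concatMap (λ p → map (λ q → (proj₁ p * proj₁ q , (proj₁ (proj₂ p) , proj₂ (proj₂ p) ⊻⟨ r ⟩ proj₂ q))) y) X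

  -- Σ (x ⊻_r y₍₁₎) ⊗ y₍₂₎, i.e. ((x ⊻_r -) ⊗ id) applied to a tensor
  _⊻ˡ[_]_ : Mag → S → Mag⊗Mag → Mag⊗Mag
  x ⊻ˡ[ r ] Y = concatMap (λ p → map (λ q → (proj₁ q * proj₁ p , (proj₂ q ⊻⟨ r ⟩ proj₁ (proj₂ p) , proj₂ (proj₂ p)))) x) Y

-- After the term −T ⊗ W cancels the doubly counted T ⊗ W, the coproduct of a monomial x is the
-- sum, each with coefficient 1, of its cuts: the pairs obtained by splitting the leaves of x into an
-- initial and a final segment. Both (id ⊗ Δ) Δ x and (Δ ⊗ id) Δ x are then the sum over all ways of
-- cutting x twice, so coassociativity reduces to a permutation of lists of triples, proved by
-- induction on the tree. Only relabellings of generators are ever applied to equal elements of the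
-- quotient modules, so Δ itself never has to be shown compatible with multilinearity.
-- The Leibniz rule is the defining recursion of Δ on a grafted tree, extended bilinearly.

module Submission where

open import Defs
open import Level using (Level)
open import Function using (_∘_)
open import Data.Fin using (#_)
open import Data.Vec using ([]; _∷_)
open import Data.List using (List; []; _∷_; [_]; _++_; map; concatMap)
open import Data.List.Properties
  using (map-++; map-∘; map-id; map-cong; ++-assoc; ++-identityʳ;
         concatMap-++; concatMap-map; map-concatMap; concatMap-cong; concatMap-pure)
open import Data.List.Relation.Unary.All using (All; []; _∷_)
open import Data.List.Relation.Binary.Permutation.Propositional
  using (_↭_; refl; prep; swap; trans; ↭-refl; ↭-sym; ↭-trans; ↭-reflexive; module PermutationReasoning)
import Data.List.Relation.Binary.Permutation.Propositional.Properties as ↭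
open import Data.Product using (Σ-syntax; _×_; _,_; proj₁; proj₂; map₁; map₂)
open import Relation.Binary.Bundles using (Setoid)
open import Relation.Binary.PropositionalEquality as ≡ using (_≡_; cong; cong₂)
import Relation.Binary.Reasoning.Setoid as SetoidReasoning
import Algebra.Solver.CommutativeMonoid as CommutativeMonoidSolver

private variable
  a b c : Level
  A B C : Set a

concatMap-concatMap : (f : B → List C) (g : A → List B) (xs : List A) →
                      concatMap f (concatMap g xs) ≡ concatMap (concatMap f ∘ g) xs
concatMap-concatMap f g []       = ≡.refl
concatMap-concatMap f g (x ∷ xs) =
  ≡.trans (concatMap-++ f (g x) _) (cong (concatMap f (g x) ++_) (concatMap-concatMap f g xs))

concatMap-[] : (xs : List A) → concatMap (λ _ → []) xs ≡ [] {A = B}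
concatMap-[] []       = ≡.refl
concatMap-[] (x ∷ xs) = concatMap-[] xs

map-as-concatMap : (f : A → B) (xs : List A) → map f xs ≡ concatMap ([_] ∘ f) xs
map-as-concatMap f xs = ≡.trans (≡.sym (concatMap-pure (map f xs))) (concatMap-map [_] f xs)

concatMap⁺ : (f : A → List B) {xs ys : List A} → xs ↭ ys → concatMap f xs ↭ concatMap f ys
concatMap⁺ f refl         = ↭-refl
concatMap⁺ f (prep x p)   = ↭.++⁺ˡ (f x) (concatMap⁺ f p)
concatMap⁺ f (swap x y p) = ↭-trans (↭.shifts (f x) (f y)) (↭.++⁺ˡ (f y) (↭.++⁺ˡ (f x) (concatMap⁺ f p)))
concatMap⁺ f (trans p q)  = ↭-trans (concatMap⁺ f p) (concatMap⁺ f q)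

concatMap-cong-↭ : {f g : A → List B} → (∀ x → f x ↭ g x) → ∀ xs → concatMap f xs ↭ concatMap g xs
concatMap-cong-↭ f↭g []       = ↭-refl
concatMap-cong-↭ f↭g (x ∷ xs) = ↭.++⁺ (f↭g x) (concatMap-cong-↭ f↭g xs)

concatMap-++-↭ : (f g : A → List B) (xs : List A) →
                 concatMap (λ x → f x ++ g x) xs ↭ concatMap f xs ++ concatMap g xs
concatMap-++-↭ f g []       = ↭-refl
concatMap-++-↭ f g (x ∷ xs) = begin
  (f x ++ g x) ++ concatMap (λ x → f x ++ g x) xs ↭⟨ ↭.++⁺ˡ (f x ++ g x) (concatMap-++-↭ f g xs) ⟩
  (f x ++ g x) ++ concatMap f xs ++ concatMap g xs ≡⟨ ++-assoc (f x) (g x) _ ⟩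
  f x ++ g x ++ concatMap f xs ++ concatMap g xs   ↭⟨ ↭.++⁺ˡ (f x) (↭.shifts (g x) (concatMap f xs)) ⟩
  f x ++ concatMap f xs ++ g x ++ concatMap g xs   ≡⟨ ++-assoc (f x) (concatMap f xs) _ ⟨
  (f x ++ concatMap f xs) ++ g x ++ concatMap g xs ∎
  where open PermutationReasoning

concatMap-comm : (h : A → B → List C) (xs : List A) (ys : List B) →
                 concatMap (λ x → concatMap (h x) ys) xs ↭ concatMap (λ y → concatMap (λ x → h x y) xs) ys
concatMap-comm h []       ys = ↭-reflexive (≡.sym (concatMap-[] ys))
concatMap-comm h (x ∷ xs) ys =
  ↭-trans (↭.++⁺ˡ (concatMap (h x) ys) (concatMap-comm h xs ys))
          (↭-sym (concatMap-++-↭ (h x) (λ y → concatMap (λ x → h x y) xs) ys))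

concatMap-map-comm : (h : A → B → C) (xs : List A) (ys : List B) →
                     concatMap (λ x → map (h x) ys) xs ↭ concatMap (λ y → map (λ x → h x y) xs) ys
concatMap-map-comm h xs ys = begin
  concatMap (λ x → map (h x) ys) xs
    ≡⟨ concatMap-cong (λ x → map-as-concatMap (h x) ys) xs ⟩
  concatMap (λ x → concatMap (λ y → [ h x y ]) ys) xs
    ↭⟨ concatMap-comm (λ x y → [ h x y ]) xs ys ⟩
  concatMap (λ y → concatMap (λ x → [ h x y ]) xs) ys
    ≡⟨ concatMap-cong (λ y → map-as-concatMap (λ x → h x y) xs) ys ⟨
  concatMap (λ y → map (λ x → h x y) xs) ys ∎
  where open PermutationReasoning

concatMap²-++-↭ : (f g : A → B → List C) (xs : List A) (ys : List B) →
                  concatMap (λ x → concatMap (λ y → f x y ++ g x y) ys) xs ↭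
                  concatMap (λ x → concatMap (f x) ys) xs ++ concatMap (λ x → concatMap (g x) ys) xs
concatMap²-++-↭ f g xs ys =
  ↭-trans (concatMap-cong-↭ (λ x → concatMap-++-↭ (f x) (g x) ys) xs)
          (concatMap-++-↭ (λ x → concatMap (f x) ys) (λ x → concatMap (g x) ys) xs)

module LinearCombinations {c ℓ} (K : Field c ℓ) where
  open Field K renaming (sym to ≈-sym; trans to ≈-trans)

  formalSum : List A → List (Carrier × A)
  formalSum = map (1# ,_)

  cancellingPairs : List A → List (Carrier × A)
  cancellingPairs = concatMap (λ x → (1# , x) ∷ (- 1# , x) ∷ [])

  relabel : Carrier → (A → B) → List (Carrier × A) → List (Carrier × B)
  relabel a h = map (λ q → (a * proj₁ q , h (proj₂ q)))

  map₂-formalSum : (h : A → B) (xs : List A) → map (map₂ h) (formalSum xs) ≡ formalSum (map h xs)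
  map₂-formalSum h xs = ≡.trans (≡.sym (map-∘ xs)) (map-∘ xs)

  map₂-cancellingPairs : (h : A → B) (xs : List A) →
                         map (map₂ h) (cancellingPairs xs) ≡ cancellingPairs (map h xs)
  map₂-cancellingPairs h []       = ≡.refl
  map₂-cancellingPairs h (x ∷ xs) = cong (λ ps → (1# , h x) ∷ (- 1# , h x) ∷ ps) (map₂-cancellingPairs h xs)

  module Properties {g b} {G : Set g} (Basic : List (Carrier × G) → List (Carrier × G) → Set b) where
    open FreeModule K G Basic public

    ≈F-setoid : Setoid _ _
    ≈F-setoid = record
      { Carrier = Comb ; _≈_ = _≈F_
      ; isEquivalence = record { refl = ≈F-refl ; sym = ≈F-sym ; trans = ≈F-trans } }

    module ≈F-Reasoning = SetoidReasoning ≈F-setoid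

    ≡⇒≈F : ∀ {xs ys} → xs ≡ ys → xs ≈F ys
    ≡⇒≈F ≡.refl = ≈F-refl

    ↭⇒≈F : ∀ {xs ys} → xs ↭ ys → xs ≈F ys
    ↭⇒≈F refl         = ≈F-refl
    ↭⇒≈F (prep x p)   = ++-cong {[ x ]} ≈F-refl (↭⇒≈F p)
    ↭⇒≈F (swap x y p) = ++-cong (++-comm [ x ] [ y ]) (↭⇒≈F p)
    ↭⇒≈F (trans p q)  = ≈F-trans (↭⇒≈F p) (↭⇒≈F q)

    concatMap-cong≈F : {f g : A → Comb} → (∀ x → f x ≈F g x) → ∀ xs → concatMap f xs ≈F concatMap g xs
    concatMap-cong≈F f≈g []       = ≈F-refl
    concatMap-cong≈F f≈g (x ∷ xs) = ++-cong (f≈g x) (concatMap-cong≈F f≈g xs)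

    concatMap-congᴬ≈F : ∀ {p} {P : A → Set p} {f g : A → Comb} → (∀ x → P x → f x ≈F g x) →
                        ∀ {xs} → All P xs → concatMap f xs ≈F concatMap g xs
    concatMap-congᴬ≈F f≈g []         = ≈F-refl
    concatMap-congᴬ≈F f≈g (px ∷ pxs) = ++-cong (f≈g _ px) (concatMap-congᴬ≈F f≈g pxs)

    map-coef-cong : (k : A → G) {c₁ c₂ : A → Carrier} → (∀ x → c₁ x ≈ c₂ x) →
                    ∀ xs → map (λ x → (c₁ x , k x)) xs ≈F map (λ x → (c₂ x , k x)) xs
    map-coef-cong k c₁≈c₂ []       = ≈F-refl
    map-coef-cong k c₁≈c₂ (x ∷ xs) = ++-cong (coef-cong (k x) (c₁≈c₂ x)) (map-coef-cong k c₁≈c₂ xs)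

    cancellingPairs≈[] : ∀ xs → cancellingPairs xs ≈F []
    cancellingPairs≈[] xs = ≈F-trans (concatMap-cong≈F cancel xs) (≡⇒≈F (concatMap-[] xs))
      where
      cancel : ∀ x → ((1# , x) ∷ (- 1# , x) ∷ []) ≈F []
      cancel x = ≈F-trans (merge 1# (- 1#) x) (≈F-trans (coef-cong x (-‿inverseʳ 1#)) (zero-coef x))

    relabel-* : ∀ a b (h : A → G) xs → relabel (a * b) h xs ≈F scale a (relabel b h xs)
    relabel-* a b h xs =
      ≈F-trans (map-coef-cong (h ∘ proj₂) (λ q → *-assoc a b (proj₁ q)) xs) (≡⇒≈F (map-∘ xs))

    relabel-cancel : (h : A → G) (xs : List (Carrier × A)) → relabel 1# h xs ++ relabel (- 1#) h xs ≈F []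
    relabel-cancel h []       = ≈F-refl
    relabel-cancel h (q ∷ xs) = begin
      u ∷ relabel 1# h xs ++ v ∷ relabel (- 1#) h xs   ≈⟨ ↭⇒≈F (prep u (↭.shift v (relabel 1# h xs) _)) ⟩
      (u ∷ v ∷ []) ++ relabel 1# h xs ++ relabel (- 1#) h xs ≈⟨ ++-cong u+v≈0 (relabel-cancel h xs) ⟩
      []                                                 ∎
      where
      open ≈F-Reasoning
      u v : Carrier × G
      u = (1# * proj₁ q , h (proj₂ q))
      v = (- 1# * proj₁ q , h (proj₂ q))
      1-1≈0 : 1# * proj₁ q + - 1# * proj₁ q ≈ 0#
      1-1≈0 = ≈-trans (≈-sym (distribʳ (proj₁ q) 1# (- 1#)))
                      (≈-trans (*-congʳ (-‿inverseʳ 1#)) (zeroˡ (proj₁ q)))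
      u+v≈0 : (u ∷ v ∷ []) ≈F []
      u+v≈0 = ≈F-trans (merge _ _ (h (proj₂ q))) (≈F-trans (coef-cong _ 1-1≈0) (zero-coef _))

    relabel-formalSum : (h : A → G) (xs : List A) → relabel 1# h (formalSum xs) ≈F formalSum (map h xs)
    relabel-formalSum h xs =
      ≈F-trans (≡⇒≈F (≡.sym (map-∘ xs)))
               (≈F-trans (map-coef-cong h (λ _ → *-identityˡ 1#) xs) (≡⇒≈F (map-∘ xs)))

  module _ {g g' b b'} {G : Set g} {G' : Set g'}
           {Basic : List (Carrier × G) → List (Carrier × G) → Set b}
           {Basic' : List (Carrier × G') → List (Carrier × G') → Set b'} where
    private
      module Q  = Properties Basic
      module Q' = Properties Basic'

    Respects : (G → G') → Set _
    Respects h = ∀ {xs ys} → Basic xs ys → map (map₂ h) xs Q'.≈F map (map₂ h) ys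

    map₂-cong : ∀ {h} → Respects h → ∀ {xs ys} → xs Q.≈F ys → map (map₂ h) xs Q'.≈F map (map₂ h) ys
    map₂-cong resp (Q.basic B)        = resp B
    map₂-cong resp Q.≈F-refl          = Q'.≈F-refl
    map₂-cong resp (Q.≈F-sym p)       = Q'.≈F-sym (map₂-cong resp p)
    map₂-cong resp (Q.≈F-trans p q)   = Q'.≈F-trans (map₂-cong resp p) (map₂-cong resp q)
    map₂-cong resp (Q.++-cong {xs} {xs'} {ys} {ys'} p q) = begin
      map _ (xs ++ ys)         ≡⟨ map-++ _ xs ys ⟩
      map _ xs ++ map _ ys     ≈⟨ Q'.++-cong (map₂-cong resp p) (map₂-cong resp q) ⟩
      map _ xs' ++ map _ ys'   ≡⟨ map-++ _ xs' ys' ⟨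
      map _ (xs' ++ ys')       ∎
      where open Q'.≈F-Reasoning
    map₂-cong {h} resp (Q.scale-cong d {xs} {ys} p) = begin
      map (map₂ h) (Q.scale d xs)   ≡⟨ map₂-scale xs ⟩
      Q'.scale d (map (map₂ h) xs)  ≈⟨ Q'.scale-cong d (map₂-cong resp p) ⟩
      Q'.scale d (map (map₂ h) ys)  ≡⟨ map₂-scale ys ⟨
      map (map₂ h) (Q.scale d ys)   ∎
      where
      open Q'.≈F-Reasoning
      map₂-scale : ∀ zs → map (map₂ h) (Q.scale d zs) ≡ Q'.scale d (map (map₂ h) zs)
      map₂-scale zs = ≡.trans (≡.sym (map-∘ zs)) (map-∘ zs)
    map₂-cong resp (Q.++-comm xs ys) = begin
      map _ (xs ++ ys)         ≡⟨ map-++ _ xs ys ⟩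
      map _ xs ++ map _ ys     ≈⟨ Q'.++-comm (map _ xs) (map _ ys) ⟩
      map _ ys ++ map _ xs     ≡⟨ map-++ _ ys xs ⟨
      map _ (ys ++ xs)         ∎
      where open Q'.≈F-Reasoning
    map₂-cong {h} resp (Q.merge a a' x)     = Q'.merge a a' (h x)
    map₂-cong {h} resp (Q.zero-coef x)      = Q'.zero-coef (h x)
    map₂-cong {h} resp (Q.coef-cong x a≈a') = Q'.coef-cong (h x) a≈a'

    relabel-cong : ∀ a {h} → Respects h → ∀ {xs ys} → xs Q.≈F ys → relabel a h xs Q'.≈F relabel a h ys
    relabel-cong a resp {xs} {ys} p = begin
      relabel a _ xs           ≡⟨ map-∘ xs ⟩
      Q'.scale a (map _ xs)    ≈⟨ Q'.scale-cong a (map₂-cong resp p) ⟩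
      Q'.scale a (map _ ys)    ≡⟨ map-∘ ys ⟨
      relabel a _ ys           ∎
      where open Q'.≈F-Reasoning

module _ {c ℓ m ℓm s} (K : Field c ℓ) (V : VectorSpace K m ℓm) (S : Set s) where
  open Field K renaming (sym to ≈-sym; trans to ≈-trans)
  open SMag K V S
  open LinearCombinations K
  module Q₂ = Properties B₂
  module Q₃ = Properties B₃

  ⊻-identityʳ : ∀ r x → x ⊻⟨ r ⟩ one ≡ x
  ⊻-identityʳ r one    = ≡.refl
  ⊻-identityʳ r (tr t) = ≡.refl

  -- cuts⁺ x: the cuts of x with a nonempty initial segment.
  cuts⁺ : Mono → List M2
  cuts⁺ one                = []
  cuts⁺ (tr (leaf v))      = [ tr (leaf v) , one ]
  cuts⁺ (tr (node t r w))  =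
    map (map₂ (_⊻⟨ r ⟩ tr w)) (cuts⁺ (tr t)) ++ map (map₁ (tr t ⊻⟨ r ⟩_)) (cuts⁺ (tr w))

  cuts : Mono → List M2
  cuts x = (one , x) ∷ cuts⁺ x

  cuts-⊻ʳ : ∀ r x w → cuts (x ⊻⟨ r ⟩ tr w) ≡
            map (map₂ (_⊻⟨ r ⟩ tr w)) (cuts x) ++ map (map₁ (x ⊻⟨ r ⟩_)) (cuts⁺ (tr w))
  cuts-⊻ʳ r one                 w = cong ((one , tr w) ∷_) (≡.sym (map-id (cuts⁺ (tr w))))
  cuts-⊻ʳ r (tr (leaf v))       w = ≡.refl
  cuts-⊻ʳ r (tr (node t r′ t′)) w = ≡.refl

  cuts⁺-⊻ˡ : ∀ r t y → cuts⁺ (tr t ⊻⟨ r ⟩ y) ≡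
             map (map₂ (_⊻⟨ r ⟩ y)) (cuts⁺ (tr t)) ++ map (map₁ (tr t ⊻⟨ r ⟩_)) (cuts⁺ y)
  cuts⁺-⊻ˡ r t one = begin
    cuts⁺ (tr t)
      ≡⟨ map-id (cuts⁺ (tr t)) ⟨
    map (λ c → c) (cuts⁺ (tr t))
      ≡⟨ map-cong (λ c → cong (proj₁ c ,_) (⊻-identityʳ r (proj₂ c))) (cuts⁺ (tr t)) ⟨
    map (map₂ (_⊻⟨ r ⟩ one)) (cuts⁺ (tr t))
      ≡⟨ ++-identityʳ _ ⟨
    map (map₂ (_⊻⟨ r ⟩ one)) (cuts⁺ (tr t)) ++ [] ∎
    where open ≡.≡-Reasoning
  cuts⁺-⊻ˡ r (leaf v)       (tr w) = ≡.refl
  cuts⁺-⊻ˡ r (node t r′ t′) (tr w) = ≡.refl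

  cutRight : M2 → List M3
  cutRight (x , y) = map (x ,_) (cuts y)

  cutLeft cutLeft⁺ : M2 → List M3
  cutLeft  (x , y) = map (λ (x₁ , x₂) → x₁ , x₂ , y) (cuts x)
  cutLeft⁺ (x , y) = map (λ (x₁ , x₂) → x₁ , x₂ , y) (cuts⁺ x)

  module Node (t : Tree) (r : S) (w : Tree) where
    T W : Mono
    T = tr t
    W = tr w
    Ct Cw : List M2
    Ct = cuts⁺ T
    Cw = cuts⁺ W
    α β : M2 → M2
    α = map₂ (_⊻⟨ r ⟩ W)
    β = map₁ (T ⊻⟨ r ⟩_)
    γ δ : M3 → M3
    γ (x , y , z) = x , y , z ⊻⟨ r ⟩ W
    δ = map₁ (T ⊻⟨ r ⟩_)
    glue : M2 → M2 → M3
    glue (x , y) (x′ , y′) = x , y ⊻⟨ r ⟩ x′ , y′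

    concatMap-cuts⁺ : (F : M2 → List M3) →
                      concatMap F (cuts⁺ (tr (node t r w))) ≡ concatMap (F ∘ α) Ct ++ concatMap (F ∘ β) Cw
    concatMap-cuts⁺ F = ≡.trans (concatMap-++ F (map α Ct) (map β Cw))
                                (cong₂ _++_ (concatMap-map F α Ct) (concatMap-map F β Cw))

    cutRight-α : ∀ c → cutRight (α c) ≡ map γ (cutRight c) ++ map (glue c) Cw
    cutRight-α (x , y) = begin
      map (x ,_) (cuts (y ⊻⟨ r ⟩ W))
        ≡⟨ cong (map (x ,_)) (cuts-⊻ʳ r y w) ⟩
      map (x ,_) (map α (cuts y) ++ map (map₁ (y ⊻⟨ r ⟩_)) Cw)
        ≡⟨ map-++ (x ,_) (map α (cuts y)) _ ⟩
      map (x ,_) (map α (cuts y)) ++ map (x ,_) (map (map₁ (y ⊻⟨ r ⟩_)) Cw)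
        ≡⟨ cong₂ _++_ (≡.trans (≡.sym (map-∘ (cuts y))) (map-∘ (cuts y))) (≡.sym (map-∘ Cw)) ⟩
      map γ (map (x ,_) (cuts y)) ++ map (glue (x , y)) Cw ∎
      where open ≡.≡-Reasoning

    cutRight-β : ∀ c → cutRight (β c) ≡ map δ (cutRight c)
    cutRight-β (x , y) = map-∘ (cuts y)

    cutLeft⁺-α : ∀ c → cutLeft⁺ (α c) ≡ map γ (cutLeft⁺ c)
    cutLeft⁺-α (x , y) = map-∘ (cuts⁺ x)

    cutLeft⁺-β : ∀ c → cutLeft⁺ (β c) ≡ map (λ c′ → glue c′ c) Ct ++ map δ (cutLeft⁺ c)
    cutLeft⁺-β (x , y) = begin
      map ε (cuts⁺ (T ⊻⟨ r ⟩ x))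
        ≡⟨ cong (map ε) (cuts⁺-⊻ˡ r t x) ⟩
      map ε (map (map₂ (_⊻⟨ r ⟩ x)) Ct ++ map β (cuts⁺ x))
        ≡⟨ map-++ ε (map (map₂ (_⊻⟨ r ⟩ x)) Ct) _ ⟩
      map ε (map (map₂ (_⊻⟨ r ⟩ x)) Ct) ++ map ε (map β (cuts⁺ x))
        ≡⟨ cong₂ _++_ (≡.sym (map-∘ Ct)) (≡.trans (≡.sym (map-∘ (cuts⁺ x))) (map-∘ (cuts⁺ x))) ⟩
      map (λ c′ → glue c′ (x , y)) Ct ++ map δ (cutLeft⁺ (x , y)) ∎
      where
      open ≡.≡-Reasoning
      ε : M2 → M3
      ε (x₁ , x₂) = x₁ , x₂ , y

    expandRight : concatMap cutRight (cuts⁺ (tr (node t r w))) ↭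
                  (map γ (concatMap cutRight Ct) ++ concatMap (λ c → map (glue c) Cw) Ct) ++ map δ (concatMap cutRight Cw)
    expandRight = begin
      concatMap cutRight (cuts⁺ (tr (node t r w)))
        ≡⟨ concatMap-cuts⁺ cutRight ⟩
      concatMap (cutRight ∘ α) Ct ++ concatMap (cutRight ∘ β) Cw
        ≡⟨ cong₂ _++_ (concatMap-cong cutRight-α Ct) (concatMap-cong cutRight-β Cw) ⟩
      concatMap (λ c → map γ (cutRight c) ++ map (glue c) Cw) Ct ++ concatMap (map δ ∘ cutRight) Cw
        ↭⟨ ↭.++⁺ʳ _ (concatMap-++-↭ (map γ ∘ cutRight) (λ c → map (glue c) Cw) Ct) ⟩
      (concatMap (map γ ∘ cutRight) Ct ++ concatMap (λ c → map (glue c) Cw) Ct) ++ concatMap (map δ ∘ cutRight) Cw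
        ≡⟨ cong₂ _++_ (cong (_++ concatMap (λ c → map (glue c) Cw) Ct) (≡.sym (map-concatMap γ cutRight Ct)))
                      (≡.sym (map-concatMap δ cutRight Cw)) ⟩
      (map γ (concatMap cutRight Ct) ++ concatMap (λ c → map (glue c) Cw) Ct) ++ map δ (concatMap cutRight Cw) ∎
      where open PermutationReasoning

    expandLeft : concatMap cutLeft⁺ (cuts⁺ (tr (node t r w))) ↭
                 map γ (concatMap cutLeft⁺ Ct) ++ concatMap (λ d → map (λ c → glue c d) Ct) Cw
                   ++ map δ (concatMap cutLeft⁺ Cw)
    expandLeft = begin
      concatMap cutLeft⁺ (cuts⁺ (tr (node t r w)))
        ≡⟨ concatMap-cuts⁺ cutLeft⁺ ⟩
      concatMap (cutLeft⁺ ∘ α) Ct ++ concatMap (cutLeft⁺ ∘ β) Cw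
        ≡⟨ cong₂ _++_ (concatMap-cong cutLeft⁺-α Ct) (concatMap-cong cutLeft⁺-β Cw) ⟩
      concatMap (map γ ∘ cutLeft⁺) Ct ++ concatMap (λ d → map (λ c → glue c d) Ct ++ map δ (cutLeft⁺ d)) Cw
        ↭⟨ ↭.++⁺ˡ _ (concatMap-++-↭ (λ d → map (λ c → glue c d) Ct) (map δ ∘ cutLeft⁺) Cw) ⟩
      concatMap (map γ ∘ cutLeft⁺) Ct ++ concatMap (λ d → map (λ c → glue c d) Ct) Cw ++ concatMap (map δ ∘ cutLeft⁺) Cw
        ≡⟨ cong₂ _++_ (≡.sym (map-concatMap γ cutLeft⁺ Ct))
                      (cong (concatMap (λ d → map (λ c → glue c d) Ct) Cw ++_) (≡.sym (map-concatMap δ cutLeft⁺ Cw))) ⟩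
      map γ (concatMap cutLeft⁺ Ct) ++ concatMap (λ d → map (λ c → glue c d) Ct) Cw ++ map δ (concatMap cutLeft⁺ Cw) ∎
      where open PermutationReasoning

  cuts⁺-coassoc : ∀ x → concatMap cutRight (cuts⁺ x) ↭ concatMap cutLeft⁺ (cuts⁺ x)
  cuts⁺-coassoc one               = ↭-refl
  cuts⁺-coassoc (tr (leaf v))     = ↭-refl
  cuts⁺-coassoc (tr (node t r w)) = begin
    concatMap cutRight (cuts⁺ (tr (node t r w)))
      ↭⟨ expandRight ⟩
    (map γ (concatMap cutRight Ct) ++ concatMap (λ c → map (glue c) Cw) Ct) ++ map δ (concatMap cutRight Cw)
      ↭⟨ ↭.++⁺ (↭.++⁺ (↭.map⁺ γ (cuts⁺-coassoc (tr t))) (concatMap-map-comm glue Ct Cw))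
               (↭.map⁺ δ (cuts⁺-coassoc (tr w))) ⟩
    (map γ (concatMap cutLeft⁺ Ct) ++ concatMap (λ d → map (λ c → glue c d) Ct) Cw) ++ map δ (concatMap cutLeft⁺ Cw)
      ≡⟨ ++-assoc (map γ (concatMap cutLeft⁺ Ct)) (concatMap (λ d → map (λ c → glue c d) Ct) Cw) _ ⟩
    map γ (concatMap cutLeft⁺ Ct) ++ concatMap (λ d → map (λ c → glue c d) Ct) Cw ++ map δ (concatMap cutLeft⁺ Cw)
      ↭⟨ expandLeft ⟨
    concatMap cutLeft⁺ (cuts⁺ (tr (node t r w))) ∎
    where
    open Node t r w
    open PermutationReasoning

  cuts-coassoc : ∀ x → concatMap cutRight (cuts x) ↭ concatMap cutLeft (cuts x)
  cuts-coassoc x = prep (one , one , x) (begin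
    map (one ,_) (cuts⁺ x) ++ concatMap cutRight (cuts⁺ x)
      ↭⟨ ↭.++⁺ (↭-reflexive (map-as-concatMap (one ,_) (cuts⁺ x))) (cuts⁺-coassoc x) ⟩
    concatMap (λ c → [ one , c ]) (cuts⁺ x) ++ concatMap cutLeft⁺ (cuts⁺ x)
      ↭⟨ concatMap-++-↭ (λ c → [ one , c ]) cutLeft⁺ (cuts⁺ x) ⟨
    concatMap cutLeft (cuts⁺ x) ∎)
    where open PermutationReasoning

  Δt-↭-cuts : ∀ t → Σ[ E ∈ List M2 ] Δt t ↭ formalSum (cuts (tr t)) ++ cancellingPairs E
  Δt-↭-cuts (leaf v) = [] , ↭-reflexive (≡.sym (++-identityʳ _))
  Δt-↭-cuts (node t r w) with Δt-↭-cuts t | Δt-↭-cuts w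
  ... | Et , Δt↭ | Ew , Δw↭ = (T , W) ∷ map α Et ++ map β Ew , (begin
    map (map₂ α) (Δt t) ++ map (map₂ β) (Δt w) ++ [ v ]
      ↭⟨ ↭.++⁺ (↭.map⁺ (map₂ α) Δt↭) (↭.++⁺ʳ [ v ] (↭.map⁺ (map₂ β) Δw↭)) ⟩
    map (map₂ α) (formalSum (cuts T) ++ cancellingPairs Et) ++ map (map₂ β) (formalSum (cuts W) ++ cancellingPairs Ew) ++ [ v ]
      ≡⟨ cong₂ _++_ (≡.trans (map-++ (map₂ α) (formalSum (cuts T)) _)
                             (cong₂ _++_ (map₂-formalSum α (cuts T)) (map₂-cancellingPairs α Et)))
                    (cong (_++ [ v ]) (≡.trans (map-++ (map₂ β) (formalSum (cuts W)) _)
                             (cong₂ _++_ (map₂-formalSum β (cuts W)) (map₂-cancellingPairs β Ew)))) ⟩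
    (Σt ++ Pt) ++ ((u ∷ Σw) ++ Pw) ++ [ v ]
      ↭⟨ CM.prove 6 ((x₀ ⊕ x₁) ⊕ (((x₂ ⊕ x₃) ⊕ x₄) ⊕ x₅)) ((x₀ ⊕ x₃) ⊕ (x₂ ⊕ (x₅ ⊕ (x₁ ⊕ x₄))))
                    (Σt ∷ Pt ∷ [ u ] ∷ Σw ∷ Pw ∷ [ v ] ∷ []) ⟩
    (Σt ++ Σw) ++ u ∷ v ∷ (Pt ++ Pw)
      ≡⟨ cong₂ _++_ (map-++ (1# ,_) (map α (cuts T)) (map β (cuts⁺ W)))
                    (cong (λ ps → u ∷ v ∷ ps) (concatMap-++ _ (map α Et) (map β Ew))) ⟨
    formalSum (cuts (tr (node t r w))) ++ cancellingPairs ((T , W) ∷ map α Et ++ map β Ew) ∎)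
    where
    open PermutationReasoning
    open Node t r w using (T; W; α; β)
    module CM = CommutativeMonoidSolver (↭.++-commutativeMonoid {A = Carrier × M2})
    open CM using (_⊕_; var)
    u v : Carrier × M2
    u = 1# , T , W
    v = - 1# , T , W
    Σt Σw Pt Pw : Mag⊗Mag
    Σt = formalSum (map α (cuts T))
    Σw = formalSum (map β (cuts⁺ W))
    Pt = cancellingPairs (map α Et)
    Pw = cancellingPairs (map β Ew)
    x₀ x₁ x₂ x₃ x₄ x₅ : CM.Expr 6
    x₀ = var (# 0)
    x₁ = var (# 1)
    x₂ = var (# 2)
    x₃ = var (# 3)
    x₄ = var (# 4)
    x₅ = var (# 5)

  Δm-↭-cuts : ∀ x → Σ[ E ∈ List M2 ] Δm x ↭ formalSum (cuts x) ++ cancellingPairs E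
  Δm-↭-cuts one    = [] , ↭-refl
  Δm-↭-cuts (tr t) = Δt-↭-cuts t

  Δm≈cuts : ∀ x → Δm x ≈₂ formalSum (cuts x)
  Δm≈cuts x with Δm-↭-cuts x
  ... | E , Δx↭ = begin
    Δm x                                      ≈⟨ Q₂.↭⇒≈F Δx↭ ⟩
    formalSum (cuts x) ++ cancellingPairs E   ≈⟨ Q₂.++-cong Q₂.≈F-refl (Q₂.cancellingPairs≈[] E) ⟩
    formalSum (cuts x) ++ []                  ≡⟨ ++-identityʳ _ ⟩
    formalSum (cuts x)                        ∎
    where open Q₂.≈F-Reasoning

  Δ₁ : Carrier × Mono → Mag⊗Mag
  Δ₁ (a , x) = Q₂.scale a (Δm x)

  Respects₂₃ : (M2 → M3) → Set _
  Respects₂₃ = Respects {Basic = B₂} {Basic' = B₃}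

  -- id⊗Δ and Δ⊗id are, definitionally, concatMap (applyΔ proj₂ …) and concatMap (applyΔ proj₁ …).
  applyΔ : (M2 → Mono) → (M2 → M2 → M3) → Carrier × M2 → Mag⊗³
  applyΔ factor assemble (a , c) = relabel a (assemble c) (Δm (factor c))

  module _ (factor : M2 → Mono) (assemble : M2 → M2 → M3) where
    private
      F : Carrier × M2 → Mag⊗³
      F = applyΔ factor assemble

    applyΔ-scale : ∀ a xs → concatMap F (Q₂.scale a xs) ≈₃ Q₃.scale a (concatMap F xs)
    applyΔ-scale a xs = begin
      concatMap F (Q₂.scale a xs)                ≡⟨ concatMap-map F _ xs ⟩
      concatMap (λ p → F (a * proj₁ p , proj₂ p)) xs
        ≈⟨ Q₃.concatMap-cong≈F (λ (a′ , c) → Q₃.relabel-* a a′ (assemble c) (Δm (factor c))) xs ⟩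
      concatMap (Q₃.scale a ∘ F) xs              ≡⟨ map-concatMap _ F xs ⟨
      Q₃.scale a (concatMap F xs)                ∎
      where open Q₃.≈F-Reasoning

    applyΔ-cancellingPairs : ∀ E → concatMap F (cancellingPairs E) ≈₃ []
    applyΔ-cancellingPairs E = begin
      concatMap F (cancellingPairs E)                    ≡⟨ concatMap-concatMap F _ E ⟩
      concatMap (λ c → F (1# , c) ++ F (- 1# , c) ++ []) E ≈⟨ Q₃.concatMap-cong≈F cancel E ⟩
      concatMap (λ _ → []) E                              ≡⟨ concatMap-[] E ⟩
      []                                                  ∎
      where
      open Q₃.≈F-Reasoning
      cancel : ∀ c → (F (1# , c) ++ F (- 1# , c) ++ []) ≈₃ []
      cancel c = Q₃.≈F-trans (Q₃.≡⇒≈F (cong (F (1# , c) ++_) (++-identityʳ _)))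
                             (Q₃.relabel-cancel (assemble c) (Δm (factor c)))

    module _ (respects : ∀ c → Respects₂₃ (assemble c)) where
      private
        cutsAlong : M2 → List M3
        cutsAlong c = map (assemble c) (cuts (factor c))

      applyΔ-formalSum : ∀ cs → concatMap F (formalSum cs) ≈₃ formalSum (concatMap cutsAlong cs)
      applyΔ-formalSum cs = begin
        concatMap F (formalSum cs)                       ≡⟨ concatMap-map F _ cs ⟩
        concatMap (λ c → relabel 1# (assemble c) (Δm (factor c))) cs
          ≈⟨ Q₃.concatMap-cong≈F (λ c → relabel-cong 1# (respects c) (Δm≈cuts (factor c))) cs ⟩
        concatMap (λ c → relabel 1# (assemble c) (formalSum (cuts (factor c)))) cs
          ≈⟨ Q₃.concatMap-cong≈F (λ c → Q₃.relabel-formalSum (assemble c) (cuts (factor c))) cs ⟩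
        concatMap (formalSum ∘ cutsAlong) cs             ≡⟨ map-concatMap _ cutsAlong cs ⟨
        formalSum (concatMap cutsAlong cs)               ∎
        where open Q₃.≈F-Reasoning

      applyΔ-Δm : ∀ x → concatMap F (Δm x) ≈₃ formalSum (concatMap cutsAlong (cuts x))
      applyΔ-Δm x with Δm-↭-cuts x
      ... | E , Δx↭ = begin
        concatMap F (Δm x)                                          ≈⟨ Q₃.↭⇒≈F (concatMap⁺ F Δx↭) ⟩
        concatMap F (formalSum (cuts x) ++ cancellingPairs E)       ≡⟨ concatMap-++ F (formalSum (cuts x)) _ ⟩
        concatMap F (formalSum (cuts x)) ++ concatMap F (cancellingPairs E)
          ≈⟨ Q₃.++-cong (applyΔ-formalSum (cuts x)) (applyΔ-cancellingPairs E) ⟩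
        formalSum (concatMap cutsAlong (cuts x)) ++ []              ≡⟨ ++-identityʳ _ ⟩
        formalSum (concatMap cutsAlong (cuts x))                    ∎
        where open Q₃.≈F-Reasoning

      applyΔ-Δ : ∀ X → concatMap F (Δ X) ≈₃
                 concatMap (λ (a , x) → Q₃.scale a (formalSum (concatMap cutsAlong (cuts x)))) X
      applyΔ-Δ X = begin
        concatMap F (Δ X)                                           ≡⟨ concatMap-concatMap F Δ₁ X ⟩
        concatMap (concatMap F ∘ Δ₁) X
          ≈⟨ Q₃.concatMap-cong≈F (λ (a , x) → Q₃.≈F-trans (applyΔ-scale a (Δm x))
                                                         (Q₃.scale-cong a (applyΔ-Δm x))) X ⟩
        concatMap (λ (a , x) → Q₃.scale a (formalSum (concatMap cutsAlong (cuts x)))) X ∎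
        where open Q₃.≈F-Reasoning

  id⊗Δ-respects : ∀ (c : M2) → Respects₂₃ (proj₁ c ,_)
  id⊗Δ-respects c (b₁ {ys = ys} lin) = Q₃.≈F-trans (Q₃.basic (b₂ lin)) (Q₃.≡⇒≈F (map-∘ ys))
  id⊗Δ-respects c (b₂ {ys = ys} lin) = Q₃.≈F-trans (Q₃.basic (b₃ lin)) (Q₃.≡⇒≈F (map-∘ ys))

  Δ⊗id-respects : ∀ (c : M2) → Respects₂₃ (λ (x₁ , x₂) → x₁ , x₂ , proj₂ c)
  Δ⊗id-respects c (b₁ {ys = ys} lin) = Q₃.≈F-trans (Q₃.basic (b₁ lin)) (Q₃.≡⇒≈F (map-∘ ys))
  Δ⊗id-respects c (b₂ {ys = ys} lin) = Q₃.≈F-trans (Q₃.basic (b₂ lin)) (Q₃.≡⇒≈F (map-∘ ys))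

  Δ-coassoc : ∀ X → id⊗Δ (Δ X) ≈₃ Δ⊗id (Δ X)
  Δ-coassoc X = begin
    id⊗Δ (Δ X)
      ≈⟨ applyΔ-Δ proj₂ (λ c → proj₁ c ,_) id⊗Δ-respects X ⟩
    concatMap (λ (a , x) → Q₃.scale a (formalSum (concatMap cutRight (cuts x)))) X
      ≈⟨ Q₃.concatMap-cong≈F (λ (a , x) → Q₃.scale-cong a (Q₃.↭⇒≈F (↭.map⁺ (1# ,_) (cuts-coassoc x)))) X ⟩
    concatMap (λ (a , x) → Q₃.scale a (formalSum (concatMap cutLeft (cuts x)))) X
      ≈⟨ applyΔ-Δ proj₁ (λ c (x₁ , x₂) → x₁ , x₂ , proj₂ c) Δ⊗id-respects X ⟨
    Δ⊗id (Δ X) ∎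
    where open Q₃.≈F-Reasoning

  module _ (r : S) where
    ⊻ʳ-term ⊻ˡ-term ⊗-term : Carrier × Mono → Carrier × Mono → Mag⊗Mag
    ⊻ʳ-term (a , x) (a′ , y) = map (λ (u , x₁ , x₂) → (a * u) * a′ , x₁ , x₂ ⊻⟨ r ⟩ y) (Δm x)
    ⊻ˡ-term (a , x) (a′ , y) = map (λ (u , y₁ , y₂) → a * (a′ * u) , x ⊻⟨ r ⟩ y₁ , y₂) (Δm y)
    ⊗-term  (a , x) (a′ , y) = [ - 1# * (a * a′) , x , y ]

    Δ₁-⊻ : ∀ p q → IsPositive (proj₂ p) → IsPositive (proj₂ q) →
           Δ₁ (proj₁ p * proj₁ q , proj₂ p ⊻⟨ r ⟩ proj₂ q) ≈₂ (⊻ʳ-term p q ++ ⊻ˡ-term p q ++ ⊗-term p q)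
    Δ₁-⊻ (a , tr t) (a′ , tr w) _ _ = begin
      Q₂.scale (a * a′) (map (map₂ α) (Δt t) ++ map (map₂ β) (Δt w) ++ [ - 1# , T , W ])
        ≡⟨ ≡.trans (map-++ _ (map (map₂ α) (Δt t)) _)
                   (cong (Q₂.scale (a * a′) (map (map₂ α) (Δt t)) ++_) (map-++ _ (map (map₂ β) (Δt w)) _)) ⟩
      Q₂.scale (a * a′) (map (map₂ α) (Δt t)) ++ Q₂.scale (a * a′) (map (map₂ β) (Δt w))
        ++ [ a * a′ * - 1# , T , W ]
        ≡⟨ cong₂ _++_ (≡.sym (map-∘ (Δt t))) (cong (_++ [ a * a′ * - 1# , T , W ]) (≡.sym (map-∘ (Δt w)))) ⟩
      relabel (a * a′) α (Δt t) ++ relabel (a * a′) β (Δt w) ++ [ a * a′ * - 1# , T , W ]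
        ≈⟨ Q₂.++-cong (Q₂.map-coef-cong (α ∘ proj₂) (λ (u , _) → *-comm-middle u) (Δt t))
             (Q₂.++-cong (Q₂.map-coef-cong (β ∘ proj₂) (λ (u , _) → *-assoc a a′ u) (Δt w))
               (Q₂.coef-cong (T , W) (*-comm (a * a′) (- 1#)))) ⟩
      ⊻ʳ-term (a , T) (a′ , W) ++ ⊻ˡ-term (a , T) (a′ , W) ++ ⊗-term (a , T) (a′ , W) ∎
      where
      open Q₂.≈F-Reasoning
      open Node t r w using (T; W; α; β)
      *-comm-middle : ∀ u → (a * a′) * u ≈ (a * u) * a′
      *-comm-middle u = ≈-trans (*-assoc a a′ u) (≈-trans (*-congˡ (*-comm a′ u)) (≈-sym (*-assoc a u a′)))

    module _ (x y : Mag) where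
      private
        ΣΣ : (Carrier × Mono → Carrier × Mono → Mag⊗Mag) → Mag⊗Mag
        ΣΣ F = concatMap (λ p → concatMap (F p) y) x

      Δ-⊻-expand : Δ (x ⊻[ r ] y) ≡ ΣΣ (λ p q → Δ₁ (proj₁ p * proj₁ q , proj₂ p ⊻⟨ r ⟩ proj₂ q))
      Δ-⊻-expand = ≡.trans (concatMap-concatMap Δ₁ _ x) (concatMap-cong (λ p → concatMap-map Δ₁ _ y) x)

      ⊻ʳ-as-sum : (Δ x ⊻ʳ[ r ] y) ↭ ΣΣ ⊻ʳ-term
      ⊻ʳ-as-sum = begin
        concatMap _ (concatMap Δ₁ x)                                 ≡⟨ concatMap-concatMap _ Δ₁ x ⟩
        concatMap (λ (a , x′) → concatMap _ (Q₂.scale a (Δm x′))) x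
          ≡⟨ concatMap-cong (λ (a , x′) → concatMap-map _ _ (Δm x′)) x ⟩
        concatMap (λ (a , x′) → concatMap (λ u → map (term a u) y) (Δm x′)) x
          ↭⟨ concatMap-cong-↭ (λ (a , x′) → concatMap-map-comm (term a) (Δm x′) y) x ⟩
        ΣΣ ⊻ʳ-term                                                   ∎
        where
        open PermutationReasoning
        term : Carrier → Carrier × M2 → Carrier × Mono → Carrier × M2
        term a (u , x₁ , x₂) (a′ , y′) = (a * u) * a′ , x₁ , x₂ ⊻⟨ r ⟩ y′

      ⊻ˡ-as-sum : (x ⊻ˡ[ r ] Δ y) ↭ ΣΣ ⊻ˡ-term
      ⊻ˡ-as-sum = begin
        concatMap _ (concatMap Δ₁ y)                                 ≡⟨ concatMap-concatMap _ Δ₁ y ⟩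
        concatMap (λ (a′ , y′) → concatMap _ (Q₂.scale a′ (Δm y′))) y
          ≡⟨ concatMap-cong (λ (a′ , y′) → concatMap-map _ _ (Δm y′)) y ⟩
        concatMap (λ (a′ , y′) → concatMap (λ u → map (term a′ u) x) (Δm y′)) y
          ↭⟨ concatMap-cong-↭ (λ (a′ , y′) → concatMap-map-comm (term a′) (Δm y′) x) y ⟩
        concatMap (λ q → concatMap (λ p → ⊻ˡ-term p q) x) y             ↭⟨ concatMap-comm ⊻ˡ-term x y ⟨
        ΣΣ ⊻ˡ-term                                                   ∎
        where
        open PermutationReasoning
        term : Carrier → Carrier × M2 → Carrier × Mono → Carrier × M2
        term a′ (u , y₁ , y₂) (a , x′) = a * (a′ * u) , x′ ⊻⟨ r ⟩ y₁ , y₂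

      ⊗-as-sum : Q₂.scale (- 1#) (x ⊗ y) ≡ ΣΣ ⊗-term
      ⊗-as-sum = ≡.trans (map-concatMap _ _ x)
                         (concatMap-cong (λ p → ≡.trans (≡.sym (map-∘ y)) (map-as-concatMap _ y)) x)

    Δ-⊻ : ∀ x y → Positive x → Positive y →
          Δ (x ⊻[ r ] y) ≈₂ ((Δ x ⊻ʳ[ r ] y) ++ (x ⊻ˡ[ r ] Δ y) ++ Q₂.scale (- 1#) (x ⊗ y))
    Δ-⊻ x y x⁺ y⁺ = begin
      Δ (x ⊻[ r ] y)
        ≡⟨ Δ-⊻-expand x y ⟩
      concatMap (λ p → concatMap (λ q → Δ₁ (proj₁ p * proj₁ q , proj₂ p ⊻⟨ r ⟩ proj₂ q)) y) x
        ≈⟨ Q₂.concatMap-congᴬ≈F (λ p p⁺ → Q₂.concatMap-congᴬ≈F (λ q q⁺ → Δ₁-⊻ p q p⁺ q⁺) y⁺) x⁺ ⟩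
      concatMap (λ p → concatMap (λ q → ⊻ʳ-term p q ++ ⊻ˡ-term p q ++ ⊗-term p q) y) x
        ≈⟨ Q₂.↭⇒≈F (↭-trans (concatMap²-++-↭ ⊻ʳ-term _ x y)
                            (↭.++⁺ˡ _ (concatMap²-++-↭ ⊻ˡ-term ⊗-term x y))) ⟩
      concatMap (λ p → concatMap (⊻ʳ-term p) y) x ++ concatMap (λ p → concatMap (⊻ˡ-term p) y) x
        ++ concatMap (λ p → concatMap (⊗-term p) y) x
        ≈⟨ Q₂.↭⇒≈F (↭-sym (↭.++⁺ (⊻ʳ-as-sum x y) (↭.++⁺ (⊻ˡ-as-sum x y) (↭-reflexive (⊗-as-sum x y))))) ⟩
      (Δ x ⊻ʳ[ r ] y) ++ (x ⊻ˡ[ r ] Δ y) ++ Q₂.scale (- 1#) (x ⊗ y) ∎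
      where open Q₂.≈F-Reasoning

lemma3p7 : ∀ {c ℓ m ℓm s : Level} (K : Field c ℓ) (V : VectorSpace K m ℓm) (S : Set s) (r : S) →
    let open SMag K V S in
    (∀ (X : Mag) → id⊗Δ (Δ X) ≈₃ Δ⊗id (Δ X))
    × (∀ (x y : Mag) → Positive x → Positive y →
         Δ (x ⊻[ r ] y) ≈₂ ((Δ x ⊻ʳ[ r ] y) ++ (x ⊻ˡ[ r ] Δ y) ++ F₂.scale -ONE (x ⊗ y)))
lemma3p7 K V S r = Δ-coassoc K V S , Δ-⊻ K V S r
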